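{- Let $\mathfrak{F}$ be a CI frame closed under marginalization, intersection, and ascetic extension. If $N\subseteq M$ are finite sets and $\mathcal{M}\subseteq\mathbb{S}(N)$, then $\mathrm{cl}_{\mathfrak{F}(N)}(\mathcal{M})=\mathrm{cl}_{\mathfrak{F}(M)}(\mathcal{M})$.
   Context: For a finite set $N$, $\mathbb{S}(N)$ denotes the set of all CI statements $ij|K$ with $i,j\in N$ distinct and $K\subseteq N\setminus\{i,j\}$, with $ij|K$ and $ji|K$ identified; a CI model over $N$ is a subset of $\mathbb{S}(N)$, and since $\mathbb{S}(N)\subseteq\mathbb{S}(M)$ for $N\subseteq M$ a model over $N$ is also one over $M$. A CI frame $\mathfrak{F}$ assigns to every finite set $N$ a set $\mathfrak{F}(N)$ of models over $N$ with $\mathbb{S}(N)\in\mathfrak{F}(N)$. $\mathfrak{F}$ is closed under marginalization if $\mathcal{M}\in\mathfrak{F}(N)$ and $M\subseteq N$ imply $\mathcal{M}\cap\mathbb{S}(M)\in\mathfrak{F}(M)$; closed under intersection if $\mathcal{M},\mathcal{A}\in\mathfrak{F}(N)$ imply $\mathcal{M}\cap\mathcal{A}\in\mathfrak{F}(N)$; closed under ascetic extension if $N\subseteq M$ implies $\mathfrak{F}(N)\subseteq\mathfrak{F}(M)$. For a frame closed under intersection, $\mathrm{cl}_{\mathfrak{F}(N)}(\mathcal{M})$ denotes the intersection of all $\mathcal{Z}\in\mathfrak{F}(N)$ with $\mathcal{M}\subseteq\mathcal{Z}$ (the smallest element of $\mathfrak{F}(N)$ containing $\mathcal{M}$). -}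

module Defs where

open import Data.Nat using (ℕ; _<_; _≟_)
open import Data.Bool using (Bool; true; false; _∧_)
open import Data.List using (List)
open import Data.List.Relation.Unary.Linked using (Linked)
open import Data.List.Membership.Propositional using (_∈_)
open import Data.List.Membership.DecPropositional _≟_ using (_∈?_)
open import Data.List.Relation.Unary.All using (All)
open import Relation.Nullary using (¬_)
open import Relation.Nullary.Decidable using (⌊_⌋)
open import Relation.Binary.PropositionalEquality using (_≡_)
import Data.List.Relation.Unary.All as All

-- A finite set of variables is
-- represented canonically by its strictly increasing list of elements
-- (the sortedness proof is irrelevant, so two finite sets are equal iff
-- they have the same elements).
record FinSet : Set where
  constructor finset
  field
    elems   : List ℕ
    .sorted : Linked _<_ elems
open FinSet public

_∈ₛ_ : ℕ → FinSet → Set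
i ∈ₛ N = i ∈ elems N

_∈ₛᵇ_ : ℕ → FinSet → Bool
i ∈ₛᵇ N = ⌊ i ∈? elems N ⌋

_⊆ₛ_ : FinSet → FinSet → Set
N ⊆ₛ M = ∀ {i} → i ∈ₛ N → i ∈ₛ M

_⊆ₛᵇ_ : FinSet → FinSet → Bool
K ⊆ₛᵇ N = ⌊ All.all? (λ i → i ∈? elems N) (elems K) ⌋

-- A CI statement ij|K with i ≠ j and i,j ∉ K.  The identification
-- ij|K = ji|K is realised by storing the statement with i < j.
record CIStmt : Set where
  constructor ci
  field
    i j  : ℕ
    K    : FinSet
    .i<j : i < j
    .i∉K : ¬ (i ∈ₛ K)
    .j∉K : ¬ (j ∈ₛ K)
open CIStmt public

Model : Set
Model = CIStmt → Bool

_⊆ₘ_ : Model → Model → Set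
A ⊆ₘ B = ∀ s → A s ≡ true → B s ≡ true

_∩ₘ_ : Model → Model → Model
(A ∩ₘ B) s = A s ∧ B s

𝕊 : FinSet → Model
𝕊 N s = (i s ∈ₛᵇ N) ∧ (j s ∈ₛᵇ N) ∧ (K s ⊆ₛᵇ N)

ModelOver : FinSet → Model → Set
ModelOver N A = A ⊆ₘ 𝕊 N

record CIFrame : Set₁ where
  field
    𝔉       : FinSet → Model → Set
    over    : ∀ N A → 𝔉 N A → ModelOver N A
    has-𝕊   : ∀ N → 𝔉 N (𝕊 N)
open CIFrame public

ClosedUnderMarginalization : CIFrame → Set
ClosedUnderMarginalization 𝔽 =
  ∀ N M A → 𝔉 𝔽 N A → M ⊆ₛ N → 𝔉 𝔽 M (A ∩ₘ 𝕊 M)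

ClosedUnderIntersection : CIFrame → Set
ClosedUnderIntersection 𝔽 =
  ∀ N A B → 𝔉 𝔽 N A → 𝔉 𝔽 N B → 𝔉 𝔽 N (A ∩ₘ B)

ClosedUnderAsceticExtension : CIFrame → Set
ClosedUnderAsceticExtension 𝔽 =
  ∀ N M → N ⊆ₛ M → ∀ A → 𝔉 𝔽 N A → 𝔉 𝔽 M A

cl : CIFrame → FinSet → Model → CIStmt → Set
cl 𝔽 N 𝓜 s = ∀ 𝓩 → 𝔉 𝔽 N 𝓩 → 𝓜 ⊆ₘ 𝓩 → 𝓩 s ≡ true

{-# OPTIONS --safe #-}
module Submission where

-- Every 𝓩 ∈ 𝔉(N) lies in 𝔉(M) by ascetic extension, so cl_{𝔉(M)}(𝓜) ⊆ cl_{𝔉(N)}(𝓜).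
-- Conversely, a 𝓩 ∈ 𝔉(M) containing 𝓜 ⊆ 𝕊(N) has the marginal 𝓩 ∩ 𝕊(N) ∈ 𝔉(N), which
-- still contains 𝓜 and is contained in 𝓩, so cl_{𝔉(N)}(𝓜) ⊆ 𝓩.

open import Defs
open import Data.Bool using (_∧_)
open import Data.Bool.Properties using (∧-conicalˡ)
open import Function.Bundles using (_⇔_; mk⇔)
open import Relation.Binary.PropositionalEquality using (cong₂)

∩ₘ-⊆ˡ : ∀ A B → (A ∩ₘ B) ⊆ₘ A
∩ₘ-⊆ˡ A B s = ∧-conicalˡ (A s) (B s)

⊆ₘ-∩ₘ : ∀ {A B C} → A ⊆ₘ B → A ⊆ₘ C → A ⊆ₘ (B ∩ₘ C)
⊆ₘ-∩ₘ A⊆B A⊆C s As = cong₂ _∧_ (A⊆B s As) (A⊆C s As)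

cl-antitone : ∀ 𝔽 {N M} → (∀ 𝓩 → 𝔉 𝔽 N 𝓩 → 𝔉 𝔽 M 𝓩) → ∀ 𝓜 s → cl 𝔽 M 𝓜 s → cl 𝔽 N 𝓜 s
cl-antitone 𝔽 𝔉N⊆𝔉M 𝓜 s clM 𝓩 𝓩∈𝔉N = clM 𝓩 (𝔉N⊆𝔉M 𝓩 𝓩∈𝔉N)

cl-mono-⊆ₛ : ∀ 𝔽 → ClosedUnderMarginalization 𝔽 → ∀ {N M} → N ⊆ₛ M
  → ∀ 𝓜 → 𝓜 ⊆ₘ 𝕊 N → ∀ s → cl 𝔽 N 𝓜 s → cl 𝔽 M 𝓜 s
cl-mono-⊆ₛ 𝔽 marg {N} {M} N⊆M 𝓜 𝓜⊆𝕊N s clN 𝓩 𝓩∈𝔉M 𝓜⊆𝓩 =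
  ∩ₘ-⊆ˡ 𝓩 (𝕊 N) s (clN (𝓩 ∩ₘ 𝕊 N) (marg M N 𝓩 𝓩∈𝔉M N⊆M) (⊆ₘ-∩ₘ 𝓜⊆𝓩 𝓜⊆𝕊N))

mainTheorem4 : (𝔽 : CIFrame)
    → ClosedUnderMarginalization 𝔽 → ClosedUnderIntersection 𝔽
    → ClosedUnderAsceticExtension 𝔽
    → (N M : FinSet) → N ⊆ₛ M → (𝓜 : Model) → 𝓜 ⊆ₘ 𝕊 N
    → ∀ s → cl 𝔽 N 𝓜 s ⇔ cl 𝔽 M 𝓜 s
mainTheorem4 𝔽 marg _ asc N M N⊆M 𝓜 𝓜⊆𝕊N s =
  mk⇔ (cl-mono-⊆ₛ 𝔽 marg N⊆M 𝓜 𝓜⊆𝕊N s) (cl-antitone 𝔽 (asc N M N⊆M) 𝓜 s)
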